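{- The generic $(3,2)$-hypertournament $\mathbb{T}_{3,2}$ is an expansion of the generic $3$-hypertournament $\mathbb{T}_3$ that has a SWIR.
   Context: An $n$-hypertournament ($n\ge2$) is a set $T$ with an $n$-ary relation $R$ such that every $n$-element substructure has automorphism group equal to the alternating group $A_n$ (a $2$-hypertournament is a tournament; in a $3$-hypertournament each triple of distinct points has exactly one of two cyclic orientations). A $(3,2)$-hypertournament is a set with a ternary relation $R_0$ and a binary relation $R_1$ such that $(T,R_0)$ is a $3$-hypertournament and $(T,R_1)$ is a tournament. The classes of finite $3$-hypertournaments and of finite $(3,2)$-hypertournaments are Fraïssé classes with strong amalgamation; $\mathbb{T}_3$ and $\mathbb{T}_{3,2}$ denote their Fraïssé limits. A SWIR on a Fraïssé (countable ultrahomogeneous) structure $M$ is a ternary relation $B\mathop{\smile\!\!\!\!\!\!|}_A C$ on finite substructures (base possibly empty) satisfying, with $AB$ the substructure on $A\cup B$: Invariance under $\mathrm{Aut}(M)$; Existence (for all $A,B,C$ there is $g\in\mathrm{Aut}(M)$ fixing $A$ pointwise with $gB\mathop{\smile\!\!\!\!\!\!|}_A C$, and $h$ fixing $A$ pointwise with $B\mathop{\smile\!\!\!\!\!\!|}_A hC$); Stationarity (if $B\mathop{\smile\!\!\!\!\!\!|}_A C$, $B'\mathop{\smile\!\!\!\!\!\!|}_A C$ and an automorphism fixing $A$ pointwise restricts to $\sigma:B\to B'$, then an automorphism fixing $AC$ pointwise restricts to $\sigma$; and the symmetric right version); Monotonicity ($BD\mathop{\smile\!\!\!\!\!\!|}_A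 C\Rightarrow B\mathop{\smile\!\!\!\!\!\!|}_A C\wedge D\mathop{\smile\!\!\!\!\!\!|}_{AB}C$; $B\mathop{\smile\!\!\!\!\!\!|}_A CD\Rightarrow B\mathop{\smile\!\!\!\!\!\!|}_A C\wedge B\mathop{\smile\!\!\!\!\!\!|}_{AC}D$). -}

module Defs where

open import Data.Nat using (ℕ)
open import Data.Fin using (Fin)
open import Data.List using (List; map; _++_)
open import Data.List.Membership.Propositional using (_∈_)
open import Data.Product using (Σ; _×_; _,_)
open import Data.Sum using (_⊎_)
open import Relation.Binary.PropositionalEquality using (_≡_; _≢_)
open import Relation.Nullary using (¬_)

_↔_ : Set → Set → Set
P ↔ Q = (P → Q) × (Q → P)

ExactlyOne : Set → Set → Set
ExactlyOne P Q = (P ⊎ Q) × ¬ (P × Q)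

InjectiveFn : {X Y : Set} → (X → Y) → Set
InjectiveFn f = ∀ x y → f x ≡ f y → x ≡ y

-- 3-hypertournament: each triple of distinct points carries exactly one
-- of the two cyclic orientations (automorphism group of the triple = A₃).
Is3HT : {X : Set} → (X → X → X → Set) → Set
Is3HT R =
  (∀ a b c → R a b c → (a ≢ b) × (b ≢ c) × (a ≢ c)) ×
  (∀ a b c → R a b c → R b c a) ×
  (∀ a b c → a ≢ b → b ≢ c → a ≢ c → ExactlyOne (R a b c) (R a c b))

IsTour : {X : Set} → (X → X → Set) → Set
IsTour R = (∀ a → ¬ R a a) × (∀ a b → a ≢ b → ExactlyOne (R a b) (R b a))

record Str3 (X : Set) : Set₁ where
  field
    R : X → X → X → Set

record Str32 (X : Set) : Set₁ where
  field
    R₀ : X → X → X → Set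
    R₁ : X → X → Set

reduct : {X : Set} → Str32 X → Str3 X
reduct M = record { R = Str32.R₀ M }

Is3HTStr : {X : Set} → Str3 X → Set
Is3HTStr M = Is3HT (Str3.R M)

Is32HTStr : {X : Set} → Str32 X → Set
Is32HTStr M = Is3HT (Str32.R₀ M) × IsTour (Str32.R₁ M)

record Iso3 {X Y : Set} (M : Str3 X) (N : Str3 Y) : Set where
  field
    fun  : X → Y
    inv  : Y → X
    inv-fun : ∀ x → inv (fun x) ≡ x
    fun-inv : ∀ y → fun (inv y) ≡ y
    pres : ∀ a b c → Str3.R M a b c ↔ Str3.R N (fun a) (fun b) (fun c)

record Aut32 (M : Str32 ℕ) : Set where
  field
    fun  : ℕ → ℕ
    inv  : ℕ → ℕ
    inv-fun : ∀ x → inv (fun x) ≡ x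
    fun-inv : ∀ y → fun (inv y) ≡ y
    pres₀ : ∀ a b c → Str32.R₀ M a b c ↔ Str32.R₀ M (fun a) (fun b) (fun c)
    pres₁ : ∀ a b → Str32.R₁ M a b ↔ Str32.R₁ M (fun a) (fun b)

-- Ultrahomogeneity: every isomorphism between finite substructures
-- (given by injective enumerations xs, ys : Fin k → ℕ) extends to an
-- automorphism.

Ultrahomogeneous3 : Str3 ℕ → Set
Ultrahomogeneous3 M =
  ∀ k (xs ys : Fin k → ℕ) → InjectiveFn xs → InjectiveFn ys →
  (∀ i j l → Str3.R M (xs i) (xs j) (xs l) ↔ Str3.R M (ys i) (ys j) (ys l)) →
  Σ (Iso3 M M) (λ g → ∀ i → Iso3.fun g (xs i) ≡ ys i)

Ultrahomogeneous32 : Str32 ℕ → Set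
Ultrahomogeneous32 M =
  ∀ k (xs ys : Fin k → ℕ) → InjectiveFn xs → InjectiveFn ys →
  (∀ i j l → Str32.R₀ M (xs i) (xs j) (xs l) ↔ Str32.R₀ M (ys i) (ys j) (ys l)) →
  (∀ i j → Str32.R₁ M (xs i) (xs j) ↔ Str32.R₁ M (ys i) (ys j)) →
  Σ (Aut32 M) (λ g → ∀ i → Aut32.fun g (xs i) ≡ ys i)

Embeds3 : {n : ℕ} → Str3 (Fin n) → Str3 ℕ → Set
Embeds3 {n} F M =
  Σ (Fin n → ℕ) λ e → InjectiveFn e ×
    (∀ i j l → Str3.R F i j l ↔ Str3.R M (e i) (e j) (e l))

Embeds32 : {n : ℕ} → Str32 (Fin n) → Str32 ℕ → Set
Embeds32 {n} F M =
  Σ (Fin n → ℕ) λ e → InjectiveFn e ×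
    (∀ i j l → Str32.R₀ F i j l ↔ Str32.R₀ M (e i) (e j) (e l)) ×
    (∀ i j → Str32.R₁ F i j ↔ Str32.R₁ M (e i) (e j))

-- M ≅ 𝕋₃ : a 3-hypertournament on ℕ (so its age consists of finite
-- 3-hypertournaments), ultrahomogeneous, into which every finite
-- 3-hypertournament embeds.
IsT3 : Str3 ℕ → Set₁
IsT3 M = Is3HTStr M × Ultrahomogeneous3 M ×
  (∀ n (F : Str3 (Fin n)) → Is3HTStr F → Embeds3 F M)

IsT32 : Str32 ℕ → Set₁
IsT32 M = Is32HTStr M × Ultrahomogeneous32 M ×
  (∀ n (F : Str32 (Fin n)) → Is32HTStr F → Embeds32 F M)

-- SWIR (stationary weak independence relation)
-- finite substructures are given by lists of elements; AB is A ++ B.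

SameSet : List ℕ → List ℕ → Set
SameSet l l' = ∀ x → (x ∈ l) ↔ (x ∈ l')

module _ {M : Str32 ℕ} where
  Fixes : Aut32 M → List ℕ → Set
  Fixes g A = ∀ a → a ∈ A → Aut32.fun g a ≡ a

  AgreesOn : Aut32 M → Aut32 M → List ℕ → Set
  AgreesOn g h B = ∀ b → b ∈ B → Aut32.fun g b ≡ Aut32.fun h b

-- ind B A C  reads  "B is independent from C over A"
record SWIR (M : Str32 ℕ) : Set₁ where
  field
    ind : List ℕ → List ℕ → List ℕ → Set
    -- it is a relation on finite substructures (sets), not on lists
    ind-sets : ∀ B A C B' A' C' → SameSet B B' → SameSet A A' → SameSet C C' →
               ind B A C → ind B' A' C'
    invariance : ∀ (g : Aut32 M) B A C → ind B A C →
                 ind (map (Aut32.fun g) B) (map (Aut32.fun g) A) (map (Aut32.fun g) C)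
    existenceˡ : ∀ A B C → Σ (Aut32 M) λ g → Fixes {M} g A × ind (map (Aut32.fun g) B) A C
    existenceʳ : ∀ A B C → Σ (Aut32 M) λ h → Fixes {M} h A × ind B A (map (Aut32.fun h) C)
    stationarityˡ : ∀ A B B' C → ind B A C → ind B' A C →
                    (σ : Aut32 M) → Fixes {M} σ A → SameSet (map (Aut32.fun σ) B) B' →
                    Σ (Aut32 M) λ τ → Fixes {M} τ (A ++ C) × AgreesOn {M} τ σ B
    stationarityʳ : ∀ A B C C' → ind B A C → ind B A C' →
                    (σ : Aut32 M) → Fixes {M} σ A → SameSet (map (Aut32.fun σ) C) C' →
                    Σ (Aut32 M) λ τ → Fixes {M} τ (A ++ B) × AgreesOn {M} τ σ C
    monotonicityˡ : ∀ A B C D → ind (B ++ D) A C → ind B A C × ind D (A ++ B) C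
    monotonicityʳ : ∀ A B C D → ind B A (C ++ D) → ind B A C × ind B (A ++ C) D

{-# OPTIONS --safe #-}
-- The reduct of 𝕋₃,₂ and 𝕋₃ both have the one-point extension property for finite
-- 3-hypertournaments, so back and forth yields an isomorphism. For the reduct, the finite
-- 3-hypertournament is first expanded by a tournament pulled back from 𝕋₃,₂ along an injective map
-- extending the given embedding, and then the extension property of 𝕋₃,₂ applies.
--
-- B is independent from C over A when B ∩ C ⊆ A, every arc between B∖A and C∖A points from B to C,
-- and every triple of ABC meeting both B∖A and C∖A carries the cyclic orientation induced by the
-- tournament. The structure on ABC is then determined by the structures on AB and AC, so
-- automorphisms acting on the two sides glue to a single automorphism (stationarity). For existence,
-- the amalgam of AB and AC over A built by the same recipe is a (3,2)-hypertournament; it embeds into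
-- 𝕋₃,₂ over AC, and homogeneity moves B onto its copy of AB.
module Submission where

open import Defs
open import Data.Nat using (ℕ)
open import Data.Product using (_×_)

open import Data.Empty using (⊥; ⊥-elim)
open import Data.Fin using (Fin; zero; suc)
open import Data.List using (List; []; _∷_; map; _++_; length; lookup; deduplicate; filter)
open import Data.List.Extrema.Nat using (max; xs≤max)
open import Data.List.Membership.Propositional using (_∈_; _∉_)
open import Data.List.Membership.Propositional.Properties
  using (∈-lookup; ∈-deduplicate⁺; ∈-deduplicate⁻; ∈-map⁺; ∈-map⁻; ∈-++⁻; ∈-++⁺ˡ; ∈-++⁺ʳ; ∈-filter⁺; ∈-filter⁻)
import Data.List.Membership.DecPropositional as DecMembership
open import Data.List.Properties using (map-++)
open import Data.List.Relation.Binary.Subset.Propositional using (_⊆_)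
open import Data.List.Relation.Binary.Subset.Propositional.Properties
  using (xs⊆xs++ys; xs⊆ys++xs; ++⁺ʳ; ⊆-trans; Any-resp-⊆; filter-⊆)
open import Data.List.Relation.Unary.All as All using (All; []; _∷_; all?)
open import Data.List.Relation.Unary.All.Properties using (All¬⇒¬Any)
open import Data.List.Relation.Unary.AllPairs using ([]; _∷_)
open import Data.List.Relation.Unary.Any as Any using (Any; here; there; any?)
import Data.List.Relation.Unary.Any.Properties as Any
open import Data.List.Relation.Unary.Unique.Propositional using (Unique)
open import Data.List.Relation.Unary.Unique.DecPropositional.Properties using (deduplicate-!)
open import Data.Nat using (zero; suc; _≤_; _≤′_; ≤′-refl; ≤′-step; _⊔_)
open import Data.Nat.Properties using (_≟_; ≤⇒≤′; ≤-trans; m≤m⊔n; m≤n⊔m; 1+n≰n)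
open import Data.Product using (Σ; ∃-syntax; _,_; proj₁; proj₂; uncurry)
open import Data.Sum using (_⊎_; inj₁; inj₂; [_,_]′)
open import Data.Sum.Properties using (≡-dec)
open import Data.Unit using (⊤; tt)
open import Function using (_∘_; id)
open import Relation.Binary.Definitions using (DecidableEquality)
open import Relation.Binary.PropositionalEquality using (_≡_; _≢_; refl; sym; trans; cong; subst)
open import Relation.Nullary using (¬_; yes; no; ¬?; _×-dec_)
open import Relation.Unary using (Decidable)

↔-refl : {P : Set} → P ↔ P
↔-refl = id , id

↔-sym : {P Q : Set} → P ↔ Q → Q ↔ P
↔-sym (f , g) = g , f

↔-trans : {P Q R : Set} → P ↔ Q → Q ↔ R → P ↔ R
↔-trans (f , g) (h , k) = h ∘ f , g ∘ k

ExactlyOne-resp-↔ : {P P' Q Q' : Set} → P ↔ P' → Q ↔ Q' → ExactlyOne P Q → ExactlyOne P' Q'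
ExactlyOne-resp-↔ (p , p⁻) (q , q⁻) (inj₁ x , excl) = inj₁ (p x) , λ (x , y) → excl (p⁻ x , q⁻ y)
ExactlyOne-resp-↔ (p , p⁻) (q , q⁻) (inj₂ y , excl) = inj₂ (q y) , λ (x , y) → excl (p⁻ x , q⁻ y)

↔-cong₂ : {X Y : Set} (R : X → Y → Set) {a a' : X} {b b' : Y} → a ≡ a' → b ≡ b' → R a b ↔ R a' b'
↔-cong₂ R refl refl = ↔-refl

↔-cong₃ : {X Y Z : Set} (R : X → Y → Z → Set) {a a' : X} {b b' : Y} {c c' : Z} →
          a ≡ a' → b ≡ b' → c ≡ c' → R a b c ↔ R a' b' c'
↔-cong₃ R refl refl refl = ↔-refl

Guarded : Set → Set → Set → Set
Guarded C P Q = (C × P) ⊎ (¬ C × Q)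

Guarded-yes : {C P Q : Set} → C → Guarded C P Q ↔ P
Guarded-yes c = [ proj₂ , (λ (¬c , _) → ⊥-elim (¬c c)) ]′ , (λ p → inj₁ (c , p))

Guarded-no : {C P Q : Set} → ¬ C → Guarded C P Q ↔ Q
Guarded-no ¬c = [ (λ (c , _) → ⊥-elim (¬c c)) , proj₂ ]′ , (λ q → inj₂ (¬c , q))

lookup-injective : {A : Set} {xs : List A} → Unique xs → ∀ i j → lookup xs i ≡ lookup xs j → i ≡ j
lookup-injective (_    ∷ _)      zero    zero    _ = refl
lookup-injective (x∉xs ∷ _)      zero    (suc j) e = ⊥-elim (All.lookup x∉xs (∈-lookup j) e)
lookup-injective (x∉xs ∷ _)      (suc i) zero    e = ⊥-elim (All.lookup x∉xs (∈-lookup i) (sym e))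
lookup-injective (_    ∷ unique) (suc i) (suc j) e = cong suc (lookup-injective unique i j e)

record Enumeration {A : Set} (S : List A) : Set where
  field
    size            : ℕ
    point           : Fin size → A
    point-injective : InjectiveFn point
    point∈          : ∀ i → point i ∈ S
    cover           : ∀ {a} → a ∈ S → ∃[ i ] point i ≡ a

enumerate : {A : Set} → DecidableEquality A → (S : List A) → Enumeration S
enumerate _≟_ S = record
  { size            = length distinct
  ; point           = lookup distinct
  ; point-injective = lookup-injective (deduplicate-! _≟_ S)
  ; point∈          = λ i → ∈-deduplicate⁻ _≟_ S (∈-lookup i)
  ; cover           = λ a∈S → let a∈distinct = ∈-deduplicate⁺ _≟_ a∈S in
                               Any.index a∈distinct , sym (Any.lookup-index a∈distinct)
  }
  where distinct = deduplicate _≟_ S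

infix 4 _∈_∖_
_∈_∖_ : {A : Set} → A → List A → List A → Set
x ∈ X ∖ A = x ∈ X × x ∉ A

pattern 1st = here refl
pattern 2nd = there (here refl)
pattern 3rd = there (there (here refl))

pair-⊆ : {A : Set} {a b : A} {t : List A} → a ∈ t → b ∈ t → a ∷ b ∷ [] ⊆ t
pair-⊆ a∈ b∈ 1st = a∈
pair-⊆ a∈ b∈ 2nd = b∈

triple-⊆ : {A : Set} {a b c : A} {t : List A} → a ∈ t → b ∈ t → c ∈ t → a ∷ b ∷ c ∷ [] ⊆ t
triple-⊆ a∈ b∈ c∈ 1st = a∈
triple-⊆ a∈ b∈ c∈ 2nd = b∈
triple-⊆ a∈ b∈ c∈ 3rd = c∈

++-⊆ : {A : Set} {xs ys zs : List A} → xs ⊆ zs → ys ⊆ zs → xs ++ ys ⊆ zs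
++-⊆ {xs = xs} xs⊆zs ys⊆zs x∈ = [ xs⊆zs , ys⊆zs ]′ (∈-++⁻ xs x∈)

Any-pair : {A : Set} {P Q : A → Set} {a b : A} → (∀ {x} → P x → Q x → ⊥) →
           Any P (a ∷ b ∷ []) → Any Q (a ∷ b ∷ []) → (P a × Q b) ⊎ (P b × Q a)
Any-pair excl (here pa)         (here qa)         = ⊥-elim (excl pa qa)
Any-pair excl (here pa)         (there (here qb)) = inj₁ (pa , qb)
Any-pair excl (there (here pb)) (here qa)         = inj₂ (pb , qa)
Any-pair excl (there (here pb)) (there (here qb)) = ⊥-elim (excl pb qb)

All×¬All⇒Any : {A : Set} {P Q R : A → Set} → Decidable Q → (∀ {w} → P w → ¬ Q w → R w) →
         ∀ {t} → All P t → ¬ All Q t → Any R t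
All×¬All⇒Any Q? PQ⇒R []       ¬all = ⊥-elim (¬all [])
All×¬All⇒Any Q? PQ⇒R {t = w ∷ _} (p ∷ ps) ¬all with Q? w
... | yes q = there (All×¬All⇒Any Q? PQ⇒R ps (¬all ∘ (q ∷_)))
... | no ¬q = here (PQ⇒R p ¬q)

suc-max-∉ : (xs : List ℕ) → suc (max 0 xs) ∉ xs
suc-max-∉ xs m = 1+n≰n (All.lookup (xs≤max 0 xs) m)

injective-extension : {L : List ℕ} (j : ℕ → ℕ) → (∀ {a b} → a ∈ L → b ∈ L → j a ≡ j b → a ≡ b) → (x : ℕ) →
                      Σ (ℕ → ℕ) λ k → (∀ {a b} → a ∈ x ∷ L → b ∈ x ∷ L → k a ≡ k b → a ≡ b) ×
                                      (∀ {a} → a ∈ L → k a ≡ j a)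
injective-extension {L} j j-injective x = k , k-injective , k≡j
  where
  open DecMembership _≟_ using (_∈?_)
  k : ℕ → ℕ
  k a with a ∈? L
  ... | yes _ = j a
  ... | no _  = suc (max 0 (map j L))
  k≡j : ∀ {a} → a ∈ L → k a ≡ j a
  k≡j {a} a∈L with a ∈? L
  ... | yes _   = refl
  ... | no a∉L = ⊥-elim (a∉L a∈L)
  the-new-point : ∀ {c} → c ∈ x ∷ L → c ∉ L → c ≡ x
  the-new-point (here c≡x) _    = c≡x
  the-new-point (there c∈L) c∉L = ⊥-elim (c∉L c∈L)
  k-injective : ∀ {a b} → a ∈ x ∷ L → b ∈ x ∷ L → k a ≡ k b → a ≡ b
  k-injective {a} {b} a∈ b∈ eq with a ∈? L | b ∈? L
  ... | yes a∈L | yes b∈L = j-injective a∈L b∈L eq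
  ... | yes a∈L | no _    = ⊥-elim (suc-max-∉ (map j L) (subst (_∈ map j L) eq (∈-map⁺ j a∈L)))
  ... | no _    | yes b∈L = ⊥-elim (suc-max-∉ (map j L) (subst (_∈ map j L) (sym eq) (∈-map⁺ j b∈L)))
  ... | no a∉L  | no b∉L  = trans (the-new-point a∈ a∉L) (sym (the-new-point b∈ b∉L))

record Is3HTOn {X : Set} (P : List X) (R : X → X → X → Set) : Set where
  field
    distinct        : ∀ {a b c} → a ∈ P → b ∈ P → c ∈ P → R a b c → (a ≢ b) × (b ≢ c) × (a ≢ c)
    rotate          : ∀ {a b c} → a ∈ P → b ∈ P → c ∈ P → R a b c → R b c a
    one-orientation : ∀ {a b c} → a ∈ P → b ∈ P → c ∈ P → a ≢ b → b ≢ c → a ≢ c →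
                      ExactlyOne (R a b c) (R a c b)

record IsTourOn {X : Set} (P : List X) (R : X → X → Set) : Set where
  field
    irreflexive   : ∀ {a} → a ∈ P → ¬ R a a
    one-direction : ∀ {a b} → a ∈ P → b ∈ P → a ≢ b → ExactlyOne (R a b) (R b a)

  asymmetric : ∀ {a b} → a ∈ P → b ∈ P → R a b → R b a → ⊥
  asymmetric a∈P b∈P r s = proj₂ (one-direction a∈P b∈P a≢b) (r , s)
    where
    a≢b : _ ≢ _
    a≢b refl = irreflexive a∈P r

Is32HTOn : {X : Set} → List X → Str32 X → Set
Is32HTOn P G = Is3HTOn P (Str32.R₀ G) × IsTourOn P (Str32.R₁ G)

Is3HT⇒Is3HTOn : {X : Set} {R : X → X → X → Set} {P : List X} → Is3HT R → Is3HTOn P R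
Is3HT⇒Is3HTOn (distinct , rotate , one-orientation) = record
  { distinct        = λ _ _ _ → distinct _ _ _
  ; rotate          = λ _ _ _ → rotate _ _ _
  ; one-orientation = λ _ _ _ → one-orientation _ _ _
  }

module _ {X Y : Set} {P : List X} (e : Y → X) (e-injective : InjectiveFn e) (e∈P : ∀ y → e y ∈ P) where

  private
    ≢-comap : ∀ {a b} → e a ≢ e b → a ≢ b
    ≢-comap ne refl = ne refl

    ≢-map : ∀ {a b} → a ≢ b → e a ≢ e b
    ≢-map ne eq = ne (e-injective _ _ eq)

  Is3HTOn-comap : {R : X → X → X → Set} → Is3HTOn P R → Is3HT (λ a b c → R (e a) (e b) (e c))
  Is3HTOn-comap ht =
    (λ a b c r → let (ab , bc , ac) = distinct (e∈P a) (e∈P b) (e∈P c) r in ≢-comap ab , ≢-comap bc , ≢-comap ac) ,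
    (λ a b c → rotate (e∈P a) (e∈P b) (e∈P c)) ,
    (λ a b c ab bc ac → one-orientation (e∈P a) (e∈P b) (e∈P c) (≢-map ab) (≢-map bc) (≢-map ac))
    where open Is3HTOn ht

  IsTourOn-comap : {R : X → X → Set} → IsTourOn P R → IsTour (λ a b → R (e a) (e b))
  IsTourOn-comap tour =
    (λ a → irreflexive (e∈P a)) ,
    (λ a b ab → one-direction (e∈P a) (e∈P b) (≢-map ab))
    where open IsTourOn tour

IsTour-asymmetric : {X : Set} {R : X → X → Set} → IsTour R → ∀ {a b} → R a b → R b a → ⊥
IsTour-asymmetric (irreflexive , one-direction) {a} {b} r s = proj₂ (one-direction a b a≢b) (r , s)
  where
  a≢b : a ≢ b
  a≢b refl = irreflexive a r

Cyclic : {W : Set} → (W → W → Set) → W → W → W → Set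
Cyclic T x y z = (T x y × T y z) ⊎ (T y z × T z x) ⊎ (T z x × T x y)

module _ {W : Set} {T : W → W → Set} where

  Cyclic-rotate : ∀ {x y z} → Cyclic T x y z → Cyclic T y z x
  Cyclic-rotate (inj₁ arcs)        = inj₂ (inj₂ arcs)
  Cyclic-rotate (inj₂ (inj₁ arcs)) = inj₁ arcs
  Cyclic-rotate (inj₂ (inj₂ arcs)) = inj₂ (inj₁ arcs)

  Cyclic-Is3HTOn : {P : List W} → IsTourOn P T → Is3HTOn P (Cyclic T)
  Cyclic-Is3HTOn {P} tour = record
    { distinct        = distinct
    ; rotate          = λ _ _ _ → Cyclic-rotate
    ; one-orientation = one-orientation
    }
    where
    open IsTourOn tour
    distinct : ∀ {a b c} → a ∈ P → b ∈ P → c ∈ P → Cyclic T a b c → (a ≢ b) × (b ≢ c) × (a ≢ c)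
    distinct a∈ b∈ c∈ (inj₁ (ab , bc)) =
      (λ { refl → irreflexive a∈ ab }) , (λ { refl → irreflexive b∈ bc }) , (λ { refl → asymmetric a∈ b∈ ab bc })
    distinct a∈ b∈ c∈ (inj₂ (inj₁ (bc , ca))) =
      (λ { refl → asymmetric b∈ c∈ bc ca }) , (λ { refl → irreflexive b∈ bc }) , (λ { refl → irreflexive c∈ ca })
    distinct a∈ b∈ c∈ (inj₂ (inj₂ (ca , ab))) =
      (λ { refl → irreflexive a∈ ab }) , (λ { refl → asymmetric a∈ b∈ ab ca }) , (λ { refl → irreflexive c∈ ca })
    one-orientation : ∀ {a b c} → a ∈ P → b ∈ P → c ∈ P → a ≢ b → b ≢ c → a ≢ c →
                      ExactlyOne (Cyclic T a b c) (Cyclic T a c b)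
    one-orientation {a} {b} {c} a∈ b∈ c∈ a≢b b≢c a≢c =
      some (proj₁ (one-direction a∈ b∈ a≢b)) (proj₁ (one-direction b∈ c∈ b≢c))
           (proj₁ (one-direction c∈ a∈ (a≢c ∘ sym))) ,
      not-both
      where
      ab⊥ = asymmetric a∈ b∈
      bc⊥ = asymmetric b∈ c∈
      ca⊥ = asymmetric c∈ a∈
      some : T a b ⊎ T b a → T b c ⊎ T c b → T c a ⊎ T a c → Cyclic T a b c ⊎ Cyclic T a c b
      some (inj₁ ab) (inj₁ bc) _          = inj₁ (inj₁ (ab , bc))
      some (inj₁ ab) (inj₂ cb) (inj₁ ca) = inj₁ (inj₂ (inj₂ (ca , ab)))
      some (inj₁ ab) (inj₂ cb) (inj₂ ac) = inj₂ (inj₁ (ac , cb))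
      some (inj₂ ba) (inj₁ bc) (inj₁ ca) = inj₁ (inj₂ (inj₁ (bc , ca)))
      some (inj₂ ba) (inj₁ bc) (inj₂ ac) = inj₂ (inj₂ (inj₂ (ba , ac)))
      some (inj₂ ba) (inj₂ cb) _          = inj₂ (inj₂ (inj₁ (cb , ba)))
      not-both : ¬ (Cyclic T a b c × Cyclic T a c b)
      not-both (inj₁ (ab , bc)        , inj₁ (ac , cb))        = bc⊥ bc cb
      not-both (inj₁ (ab , bc)        , inj₂ (inj₁ (cb , ba))) = ab⊥ ab ba
      not-both (inj₁ (ab , bc)        , inj₂ (inj₂ (ba , ac))) = ab⊥ ab ba
      not-both (inj₂ (inj₁ (bc , ca)) , inj₁ (ac , cb))        = bc⊥ bc cb
      not-both (inj₂ (inj₁ (bc , ca)) , inj₂ (inj₁ (cb , ba))) = bc⊥ bc cb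
      not-both (inj₂ (inj₁ (bc , ca)) , inj₂ (inj₂ (ba , ac))) = ca⊥ ca ac
      not-both (inj₂ (inj₂ (ca , ab)) , inj₁ (ac , cb))        = ca⊥ ca ac
      not-both (inj₂ (inj₂ (ca , ab)) , inj₂ (inj₁ (cb , ba))) = ab⊥ ab ba
      not-both (inj₂ (inj₂ (ca , ab)) , inj₂ (inj₂ (ba , ac))) = ca⊥ ca ac

Cyclic-resp-↔ : {W V : Set} (T : W → W → Set) (T' : V → V → Set) {x y z : W} {x' y' z' : V} →
                T x y ↔ T' x' y' → T y z ↔ T' y' z' → T z x ↔ T' z' x' →
                Cyclic T x y z ↔ Cyclic T' x' y' z'
Cyclic-resp-↔ T T' (xy , xy⁻) (yz , yz⁻) (zx , zx⁻) =
  [ (λ (p , q) → inj₁ (xy p , yz q)) , [ (λ (p , q) → inj₂ (inj₁ (yz p , zx q))) , (λ (p , q) → inj₂ (inj₂ (zx p , xy q))) ]′ ]′ ,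
  [ (λ (p , q) → inj₁ (xy⁻ p , yz⁻ q)) , [ (λ (p , q) → inj₂ (inj₁ (yz⁻ p , zx⁻ q))) , (λ (p , q) → inj₂ (inj₂ (zx⁻ p , xy⁻ q))) ]′ ]′

record EmbeddingOn₃ {X Y : Set} (F : Str3 X) (G : Str3 Y) (P : List X) (f : X → Y) : Set where
  field
    injective : ∀ {a b} → a ∈ P → b ∈ P → f a ≡ f b → a ≡ b
    preserves : ∀ {a b c} → a ∈ P → b ∈ P → c ∈ P → Str3.R F a b c ↔ Str3.R G (f a) (f b) (f c)

record EmbeddingOn₃₂ {X Y : Set} (F : Str32 X) (G : Str32 Y) (P : List X) (f : X → Y) : Set where
  field
    injective  : ∀ {a b} → a ∈ P → b ∈ P → f a ≡ f b → a ≡ b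
    preserves₀ : ∀ {a b c} → a ∈ P → b ∈ P → c ∈ P → Str32.R₀ F a b c ↔ Str32.R₀ G (f a) (f b) (f c)
    preserves₁ : ∀ {a b} → a ∈ P → b ∈ P → Str32.R₁ F a b ↔ Str32.R₁ G (f a) (f b)

module _ {X Y : Set} {F : Str3 X} {G : Str3 Y} {P : List X} {f : X → Y} (emb : EmbeddingOn₃ F G P f) where
  open EmbeddingOn₃ emb

  EmbeddingOn₃-⊆ : {Q : List X} → Q ⊆ P → EmbeddingOn₃ F G Q f
  EmbeddingOn₃-⊆ Q⊆P = record
    { injective = λ a b → injective (Q⊆P a) (Q⊆P b)
    ; preserves = λ a b c → preserves (Q⊆P a) (Q⊆P b) (Q⊆P c)
    }

  EmbeddingOn₃-∘ : {Z : Set} {H : Str3 Z} {Q : List Y} {g : Y → Z} → EmbeddingOn₃ G H Q g →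
                   (∀ {a} → a ∈ P → f a ∈ Q) → EmbeddingOn₃ F H P (g ∘ f)
  EmbeddingOn₃-∘ emb-g f∈Q = record
    { injective = λ a b eq → injective a b (EmbeddingOn₃.injective emb-g (f∈Q a) (f∈Q b) eq)
    ; preserves = λ a b c → ↔-trans (preserves a b c) (EmbeddingOn₃.preserves emb-g (f∈Q a) (f∈Q b) (f∈Q c))
    }

module _ {X Y : Set} {F : Str32 X} {G : Str32 Y} {P : List X} {f : X → Y} (emb : EmbeddingOn₃₂ F G P f) where
  open EmbeddingOn₃₂ emb

  EmbeddingOn₃₂-⊆ : {Q : List X} → Q ⊆ P → EmbeddingOn₃₂ F G Q f
  EmbeddingOn₃₂-⊆ Q⊆P = record
    { injective  = λ a b → injective (Q⊆P a) (Q⊆P b)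
    ; preserves₀ = λ a b c → preserves₀ (Q⊆P a) (Q⊆P b) (Q⊆P c)
    ; preserves₁ = λ a b → preserves₁ (Q⊆P a) (Q⊆P b)
    }

  EmbeddingOn₃₂-∘ : {Z : Set} {H : Str32 Z} {Q : List Y} {g : Y → Z} → EmbeddingOn₃₂ G H Q g →
                    (∀ {a} → a ∈ P → f a ∈ Q) → EmbeddingOn₃₂ F H P (g ∘ f)
  EmbeddingOn₃₂-∘ emb-g f∈Q = record
    { injective  = λ a b eq → injective a b (G.injective (f∈Q a) (f∈Q b) eq)
    ; preserves₀ = λ a b c → ↔-trans (preserves₀ a b c) (G.preserves₀ (f∈Q a) (f∈Q b) (f∈Q c))
    ; preserves₁ = λ a b → ↔-trans (preserves₁ a b) (G.preserves₁ (f∈Q a) (f∈Q b))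
    }
    where module G = EmbeddingOn₃₂ emb-g

  EmbeddingOn₃₂-cong : {f' : X → Y} → (∀ {a} → a ∈ P → f' a ≡ f a) → EmbeddingOn₃₂ F G P f'
  EmbeddingOn₃₂-cong f'≡f = record
    { injective  = λ a b eq → injective a b (trans (sym (f'≡f a)) (trans eq (f'≡f b)))
    ; preserves₀ = λ a b c → ↔-trans (preserves₀ a b c)
                               (↔-cong₃ (Str32.R₀ G) (sym (f'≡f a)) (sym (f'≡f b)) (sym (f'≡f c)))
    ; preserves₁ = λ a b → ↔-trans (preserves₁ a b) (↔-cong₂ (Str32.R₁ G) (sym (f'≡f a)) (sym (f'≡f b)))
    }

EmbeddingOn₃₂-id : {X : Set} {F : Str32 X} {P : List X} → EmbeddingOn₃₂ F F P id
EmbeddingOn₃₂-id = record { injective = λ _ _ → id ; preserves₀ = λ _ _ _ → ↔-refl ; preserves₁ = λ _ _ → ↔-refl }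

Iso3-embeddingOn : {N : Str3 ℕ} (g : Iso3 N N) {P : List ℕ} → EmbeddingOn₃ N N P (Iso3.fun g)
Iso3-embeddingOn g = record
  { injective = λ {a} {b} _ _ eq → trans (sym (Iso3.inv-fun g a)) (trans (cong (Iso3.inv g) eq) (Iso3.inv-fun g b))
  ; preserves = λ _ _ _ → Iso3.pres g _ _ _
  }

Aut32-injective : {M : Str32 ℕ} (g : Aut32 M) → InjectiveFn (Aut32.fun g)
Aut32-injective g x y eq = trans (sym (Aut32.inv-fun g x)) (trans (cong (Aut32.inv g) eq) (Aut32.inv-fun g y))

Aut32-embeddingOn : {M : Str32 ℕ} (g : Aut32 M) {P : List ℕ} → EmbeddingOn₃₂ M M P (Aut32.fun g)
Aut32-embeddingOn g = record
  { injective  = λ _ _ → Aut32-injective g _ _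
  ; preserves₀ = λ _ _ _ → Aut32.pres₀ g _ _ _
  ; preserves₁ = λ _ _ → Aut32.pres₁ g _ _
  }

Aut32-id : {M : Str32 ℕ} → Aut32 M
Aut32-id = record
  { fun = id ; inv = id ; inv-fun = λ _ → refl ; fun-inv = λ _ → refl
  ; pres₀ = λ _ _ _ → ↔-refl ; pres₁ = λ _ _ → ↔-refl }

Aut32-inverse : {M : Str32 ℕ} → Aut32 M → Aut32 M
Aut32-inverse {M} g = record
  { fun     = inv
  ; inv     = fun
  ; inv-fun = fun-inv
  ; fun-inv = inv-fun
  ; pres₀   = λ a b c → ↔-sym (↔-trans (pres₀ (inv a) (inv b) (inv c))
                                        (↔-cong₃ (Str32.R₀ M) (fun-inv a) (fun-inv b) (fun-inv c)))
  ; pres₁   = λ a b → ↔-sym (↔-trans (pres₁ (inv a) (inv b)) (↔-cong₂ (Str32.R₁ M) (fun-inv a) (fun-inv b)))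
  }
  where open Aut32 g

Fixes⇒map-⊆ : {M : Str32 ℕ} (g : Aut32 M) {A : List ℕ} → Fixes {M} g A → map (Aut32.fun g) A ⊆ A
Fixes⇒map-⊆ g {A} g-fixes y∈ with ∈-map⁻ (Aut32.fun g) y∈
... | a , a∈A , refl = subst (_∈ A) (sym (g-fixes a a∈A)) a∈A

Fixes⇒⊆-map : {M : Str32 ℕ} (g : Aut32 M) {A : List ℕ} → Fixes {M} g A → A ⊆ map (Aut32.fun g) A
Fixes⇒⊆-map g {A} g-fixes {a} a∈A = subst (_∈ map (Aut32.fun g) A) (g-fixes a a∈A) (∈-map⁺ (Aut32.fun g) a∈A)

Fixes-∉ : {M : Str32 ℕ} (σ : Aut32 M) {A : List ℕ} {x : ℕ} → Fixes {M} σ A → x ∉ A → Aut32.fun σ x ∉ A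
Fixes-∉ σ {A} σ-fixes x∉A σx∈A = x∉A (subst (_∈ A) (Aut32-injective σ _ _ (σ-fixes _ σx∈A)) σx∈A)

module _ {M : Str32 ℕ} {Y : Set} (_≟_ : DecidableEquality Y) where

  homogeneous₃₂ : Ultrahomogeneous32 M → {F : Str32 Y} {S : List Y} {p q : Y → ℕ} →
                  EmbeddingOn₃₂ F M S p → EmbeddingOn₃₂ F M S q →
                  Σ (Aut32 M) λ g → ∀ {y} → y ∈ S → Aut32.fun g (p y) ≡ q y
  homogeneous₃₂ uh {S = S} {p} {q} emb-p emb-q = g , g∘p≡q
    where
    open Enumeration (enumerate _≟_ S)
    module P = EmbeddingOn₃₂ emb-p
    module Q = EmbeddingOn₃₂ emb-q
    conjugator = uh size (p ∘ point) (q ∘ point)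
      (λ i j eq → point-injective i j (P.injective (point∈ i) (point∈ j) eq))
      (λ i j eq → point-injective i j (Q.injective (point∈ i) (point∈ j) eq))
      (λ i j k → ↔-trans (↔-sym (P.preserves₀ (point∈ i) (point∈ j) (point∈ k)))
                          (Q.preserves₀ (point∈ i) (point∈ j) (point∈ k)))
      (λ i j → ↔-trans (↔-sym (P.preserves₁ (point∈ i) (point∈ j))) (Q.preserves₁ (point∈ i) (point∈ j)))
    g = proj₁ conjugator
    g∘p≡q : ∀ {y} → y ∈ S → Aut32.fun g (p y) ≡ q y
    g∘p≡q y∈S with cover y∈S
    ... | i , refl = proj₂ conjugator i

  universal₃₂ : (∀ n (F : Str32 (Fin n)) → Is32HTStr F → Embeds32 F M) →
                {G : Str32 Y} {P : List Y} → Is32HTOn P G → Σ (Y → ℕ) (EmbeddingOn₃₂ G M P)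
  universal₃₂ univ {G} {P} (ht , tour) = f , record
    { injective  = injective
    ; preserves₀ = preserves₀
    ; preserves₁ = preserves₁
    }
    where
    open Enumeration (enumerate _≟_ P)
    open DecMembership _≟_ using (_∈?_)
    F : Str32 (Fin size)
    F = record { R₀ = λ i j k → Str32.R₀ G (point i) (point j) (point k)
               ; R₁ = λ i j → Str32.R₁ G (point i) (point j) }
    embedding = univ size F (Is3HTOn-comap point point-injective point∈ ht ,
                             IsTourOn-comap point point-injective point∈ tour)
    e = proj₁ embedding
    e-injective = proj₁ (proj₂ embedding)
    e-preserves₀ = proj₁ (proj₂ (proj₂ embedding))
    e-preserves₁ = proj₂ (proj₂ (proj₂ embedding))
    f : Y → ℕ
    f a with a ∈? P
    ... | yes a∈P = e (proj₁ (cover a∈P))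
    ... | no _    = 0
    f-spec : ∀ {a} → a ∈ P → Σ (Fin size) λ i → point i ≡ a × f a ≡ e i
    f-spec {a} a∈P with a ∈? P
    ... | yes a∈P' = proj₁ (cover a∈P') , proj₂ (cover a∈P') , refl
    ... | no a∉P   = ⊥-elim (a∉P a∈P)
    injective : ∀ {a b} → a ∈ P → b ∈ P → f a ≡ f b → a ≡ b
    injective a∈P b∈P eq with f-spec a∈P | f-spec b∈P
    ... | i , refl , fa | j , refl , fb = cong point (e-injective i j (trans (sym fa) (trans eq fb)))
    preserves₀ : ∀ {a b c} → a ∈ P → b ∈ P → c ∈ P → Str32.R₀ G a b c ↔ Str32.R₀ M (f a) (f b) (f c)
    preserves₀ a∈P b∈P c∈P with f-spec a∈P | f-spec b∈P | f-spec c∈P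
    ... | i , refl , fa | j , refl , fb | k , refl , fc rewrite fa | fb | fc = e-preserves₀ i j k
    preserves₁ : ∀ {a b} → a ∈ P → b ∈ P → Str32.R₁ G a b ↔ Str32.R₁ M (f a) (f b)
    preserves₁ a∈P b∈P with f-spec a∈P | f-spec b∈P
    ... | i , refl , fa | j , refl , fb rewrite fa | fb = e-preserves₁ i j

  extension₃₂ : IsT32 M → {G : Str32 Y} {P Bs : List Y} {j : Y → ℕ} →
                Is32HTOn P G → Bs ⊆ P → EmbeddingOn₃₂ G M Bs j →
                Σ (Y → ℕ) λ f → EmbeddingOn₃₂ G M P f × (∀ {a} → a ∈ Bs → f a ≡ j a)
  extension₃₂ (_ , uh , univ) hG Bs⊆P emb-j =
    Aut32.fun g ∘ e , EmbeddingOn₃₂-∘ emb-e (Aut32-embeddingOn g) (∈-map⁺ e) , g∘e≡j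
    where
    e = proj₁ (universal₃₂ univ hG)
    emb-e = proj₂ (universal₃₂ univ hG)
    conjugator = homogeneous₃₂ uh (EmbeddingOn₃₂-⊆ emb-e Bs⊆P) emb-j
    g = proj₁ conjugator
    g∘e≡j = proj₂ conjugator

module _ {N : Str3 ℕ} {Y : Set} (_≟_ : DecidableEquality Y) where

  homogeneous₃ : Ultrahomogeneous3 N → {F : Str3 Y} {S : List Y} {p q : Y → ℕ} →
                 EmbeddingOn₃ F N S p → EmbeddingOn₃ F N S q →
                 Σ (Iso3 N N) λ g → ∀ {y} → y ∈ S → Iso3.fun g (p y) ≡ q y
  homogeneous₃ uh {S = S} {p} {q} emb-p emb-q = g , g∘p≡q
    where
    open Enumeration (enumerate _≟_ S)
    module P = EmbeddingOn₃ emb-p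
    module Q = EmbeddingOn₃ emb-q
    conjugator = uh size (p ∘ point) (q ∘ point)
      (λ i j eq → point-injective i j (P.injective (point∈ i) (point∈ j) eq))
      (λ i j eq → point-injective i j (Q.injective (point∈ i) (point∈ j) eq))
      (λ i j k → ↔-trans (↔-sym (P.preserves (point∈ i) (point∈ j) (point∈ k)))
                          (Q.preserves (point∈ i) (point∈ j) (point∈ k)))
    g = proj₁ conjugator
    g∘p≡q : ∀ {y} → y ∈ S → Iso3.fun g (p y) ≡ q y
    g∘p≡q y∈S with cover y∈S
    ... | i , refl = proj₂ conjugator i

  universal₃ : (∀ n (F : Str3 (Fin n)) → Is3HTStr F → Embeds3 F N) →
               {G : Str3 Y} {P : List Y} → Is3HTOn P (Str3.R G) → Σ (Y → ℕ) (EmbeddingOn₃ G N P)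
  universal₃ univ {G} {P} ht = f , record { injective = injective ; preserves = preserves }
    where
    open Enumeration (enumerate _≟_ P)
    open DecMembership _≟_ using (_∈?_)
    F : Str3 (Fin size)
    F = record { R = λ i j k → Str3.R G (point i) (point j) (point k) }
    embedding = univ size F (Is3HTOn-comap point point-injective point∈ ht)
    e = proj₁ embedding
    e-injective = proj₁ (proj₂ embedding)
    e-preserves = proj₂ (proj₂ embedding)
    f : Y → ℕ
    f a with a ∈? P
    ... | yes a∈P = e (proj₁ (cover a∈P))
    ... | no _    = 0
    f-spec : ∀ {a} → a ∈ P → Σ (Fin size) λ i → point i ≡ a × f a ≡ e i
    f-spec {a} a∈P with a ∈? P
    ... | yes a∈P' = proj₁ (cover a∈P') , proj₂ (cover a∈P') , refl
    ... | no a∉P   = ⊥-elim (a∉P a∈P)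
    injective : ∀ {a b} → a ∈ P → b ∈ P → f a ≡ f b → a ≡ b
    injective a∈P b∈P eq with f-spec a∈P | f-spec b∈P
    ... | i , refl , fa | j , refl , fb = cong point (e-injective i j (trans (sym fa) (trans eq fb)))
    preserves : ∀ {a b c} → a ∈ P → b ∈ P → c ∈ P → Str3.R G a b c ↔ Str3.R N (f a) (f b) (f c)
    preserves a∈P b∈P c∈P with f-spec a∈P | f-spec b∈P | f-spec c∈P
    ... | i , refl , fa | j , refl , fb | k , refl , fc rewrite fa | fb | fc = e-preserves i j k

  extension₃ : IsT3 N → {G : Str3 Y} {P Bs : List Y} {j : Y → ℕ} →
               Is3HTOn P (Str3.R G) → Bs ⊆ P → EmbeddingOn₃ G N Bs j →
               Σ (Y → ℕ) λ f → EmbeddingOn₃ G N P f × (∀ {a} → a ∈ Bs → f a ≡ j a)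
  extension₃ (_ , uh , univ) hG Bs⊆P emb-j =
    Iso3.fun g ∘ e , EmbeddingOn₃-∘ emb-e (Iso3-embeddingOn g) (∈-map⁺ e) , g∘e≡j
    where
    e = proj₁ (universal₃ univ hG)
    emb-e = proj₂ (universal₃ univ hG)
    conjugator = homogeneous₃ uh (EmbeddingOn₃-⊆ emb-e Bs⊆P) emb-j
    g = proj₁ conjugator
    g∘e≡j = proj₂ conjugator

record PartialIso (M N : Str3 ℕ) : Set where
  field
    domain    : List ℕ
    to from   : ℕ → ℕ
    from-to   : ∀ {x} → x ∈ domain → from (to x) ≡ x
    preserves : ∀ {a b c} → a ∈ domain → b ∈ domain → c ∈ domain →
                Str3.R M a b c ↔ Str3.R N (to a) (to b) (to c)

  embedding : EmbeddingOn₃ M N domain to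
  embedding = record
    { injective = λ a∈ b∈ eq → trans (sym (from-to a∈)) (trans (cong from eq) (from-to b∈))
    ; preserves = preserves
    }

  InRange : ℕ → Set
  InRange y = ∃[ x ] x ∈ domain × to x ≡ y

open PartialIso using (domain; to; from; from-to; embedding; InRange)

module _ {M N : Str3 ℕ} where

  _⊑_ : PartialIso M N → PartialIso M N → Set
  π ⊑ ρ = ∀ {x} → x ∈ domain π → x ∈ domain ρ × to ρ x ≡ to π x

  ⊑-refl : ∀ {π} → π ⊑ π
  ⊑-refl x∈ = x∈ , refl

  ⊑-trans : ∀ {π ρ σ} → π ⊑ ρ → ρ ⊑ σ → π ⊑ σ
  ⊑-trans π⊑ρ ρ⊑σ x∈ =
    let (x∈ρ , ρx≡πx) = π⊑ρ x∈ ; (x∈σ , σx≡ρx) = ρ⊑σ x∈ρ in x∈σ , trans σx≡ρx ρx≡πx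

  inverse : PartialIso M N → PartialIso N M
  inverse π = record
    { domain    = map (to π) (domain π)
    ; to        = from π
    ; from      = to π
    ; from-to   = to-from
    ; preserves = preserves⁻¹
    }
    where
    to-from : ∀ {y} → y ∈ map (to π) (domain π) → to π (from π y) ≡ y
    to-from y∈ with ∈-map⁻ (to π) y∈
    ... | x , x∈ , refl = cong (to π) (from-to π x∈)
    preserves⁻¹ : ∀ {a b c} → a ∈ map (to π) (domain π) → b ∈ map (to π) (domain π) → c ∈ map (to π) (domain π) →
                  Str3.R N a b c ↔ Str3.R M (from π a) (from π b) (from π c)
    preserves⁻¹ a∈ b∈ c∈ with ∈-map⁻ (to π) a∈ | ∈-map⁻ (to π) b∈ | ∈-map⁻ (to π) c∈
    ... | a , a∈π , refl | b , b∈π , refl | c , c∈π , refl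
      rewrite from-to π a∈π | from-to π b∈π | from-to π c∈π = ↔-sym (PartialIso.preserves π a∈π b∈π c∈π)

module _ {M N : Str3 ℕ} where

  ⊑-inverse : ∀ {π : PartialIso M N} {ρ : PartialIso N M} → inverse π ⊑ ρ → π ⊑ inverse ρ
  ⊑-inverse {π} {ρ} π⁻¹⊑ρ x∈ =
    subst (_∈ map (to ρ) (domain ρ)) ρπx≡x (∈-map⁺ (to ρ) πx∈ρ) ,
    trans (cong (from ρ) (sym ρπx≡x)) (from-to ρ πx∈ρ)
    where
    πx∈ρ = proj₁ (π⁻¹⊑ρ (∈-map⁺ (to π) x∈))
    ρπx≡x = trans (proj₂ (π⁻¹⊑ρ (∈-map⁺ (to π) x∈))) (from-to π x∈)

OnePointExtension : Str3 ℕ → Set₁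
OnePointExtension N =
  (F : Str3 ℕ) → Is3HTStr F → {L : List ℕ} {j : ℕ → ℕ} → EmbeddingOn₃ F N L j → (x : ℕ) →
  Σ (ℕ → ℕ) λ j' → EmbeddingOn₃ F N (x ∷ L) j' × (∀ {a} → a ∈ L → j' a ≡ j a)

module _ {M N : Str3 ℕ} where

  forth : Is3HTStr M → OnePointExtension N → (π : PartialIso M N) (x : ℕ) →
          Σ (PartialIso M N) λ ρ → π ⊑ ρ × x ∈ domain ρ
  forth hM extN π x = ρ , (λ a∈ → there a∈ , j'≡to a∈) , here refl
    where
    extended = extN M hM (embedding π) x
    j' = proj₁ extended
    emb' = proj₁ (proj₂ extended)
    j'≡to = proj₂ (proj₂ extended)
    from' : ℕ → ℕ
    from' y with y ≟ j' x
    ... | yes _ = x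
    ... | no _  = from π y
    from'-j' : ∀ {a} → a ∈ x ∷ domain π → from' (j' a) ≡ a
    from'-j' {a} a∈ with j' a ≟ j' x
    ... | yes eq = EmbeddingOn₃.injective emb' (here refl) a∈ (sym eq)
    from'-j' (here refl) | no ne = ⊥-elim (ne refl)
    from'-j' (there a∈)  | no _  = trans (cong (from π) (j'≡to a∈)) (from-to π a∈)
    ρ : PartialIso M N
    ρ = record
      { domain    = x ∷ domain π
      ; to        = j'
      ; from      = from'
      ; from-to   = from'-j'
      ; preserves = EmbeddingOn₃.preserves emb'
      }

module _ {M N : Str3 ℕ} where

  back : Is3HTStr N → OnePointExtension M → (π : PartialIso M N) (y : ℕ) →
         Σ (PartialIso M N) λ ρ → π ⊑ ρ × InRange ρ y
  back hN extM π y =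
    inverse ρ , ⊑-inverse {π = π} {ρ = ρ} π⁻¹⊑ρ , (to ρ y , ∈-map⁺ (to ρ) y∈ρ , from-to ρ y∈ρ)
    where
    extended = forth hN extM (inverse π) y
    ρ = proj₁ extended
    π⁻¹⊑ρ = proj₁ (proj₂ extended)
    y∈ρ = proj₂ (proj₂ extended)

  chain-limit : (stage : ℕ → PartialIso M N) → (∀ n → stage n ⊑ stage (suc n)) →
                (∀ x → x ∈ domain (stage (suc x))) → (∀ y → InRange (stage (suc y)) y) → Iso3 M N
  chain-limit stage step total onto = record
    { fun = fun ; inv = inv ; inv-fun = inv-fun ; fun-inv = fun-inv ; pres = pres }
    where
    mono : ∀ {m n} → m ≤′ n → stage m ⊑ stage n
    mono {m} ≤′-refl                = ⊑-refl {π = stage m}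
    mono {m} (≤′-step {n} m≤n) = ⊑-trans {π = stage m} {stage n} {stage (suc n)} (mono m≤n) (step n)
    fun inv : ℕ → ℕ
    fun x = to (stage (suc x)) x
    inv y = proj₁ (onto y)
    fun-stable : ∀ {x n} → suc x ≤ n → x ∈ domain (stage n) × to (stage n) x ≡ fun x
    fun-stable x<n = mono (≤⇒≤′ x<n) (total _)
    inv-stable : ∀ {y n} → suc y ≤ n → inv y ∈ domain (stage n) × to (stage n) (inv y) ≡ y
    inv-stable {y} y<n =
      let (x∈ , x↦y) = proj₂ (onto y) ; (x∈' , eq) = mono (≤⇒≤′ y<n) x∈ in x∈' , trans eq x↦y
    fun-inv : ∀ y → fun (inv y) ≡ y
    fun-inv y = trans (sym (proj₂ (fun-stable (m≤m⊔n (suc (inv y)) (suc y)))))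
                      (proj₂ (inv-stable (m≤n⊔m (suc (inv y)) (suc y))))
    inv-fun : ∀ x → inv (fun x) ≡ x
    inv-fun x = EmbeddingOn₃.injective (embedding (stage n)) (proj₁ y-stable) (proj₁ x-stable)
                  (trans (proj₂ y-stable) (sym (proj₂ x-stable)))
      where
      n = suc x ⊔ suc (fun x)
      x-stable = fun-stable (m≤m⊔n (suc x) (suc (fun x)))
      y-stable = inv-stable (m≤n⊔m (suc x) (suc (fun x)))
    pres : ∀ a b c → Str3.R M a b c ↔ Str3.R N (fun a) (fun b) (fun c)
    pres a b c = ↔-trans (PartialIso.preserves (stage n) (proj₁ a-stable) (proj₁ b-stable) (proj₁ c-stable))
                         (↔-cong₃ (Str3.R N) (proj₂ a-stable) (proj₂ b-stable) (proj₂ c-stable))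
      where
      n = suc a ⊔ suc b ⊔ suc c
      a-stable = fun-stable (≤-trans (m≤m⊔n (suc a) (suc b)) (m≤m⊔n _ (suc c)))
      b-stable = fun-stable (≤-trans (m≤n⊔m (suc a) (suc b)) (m≤m⊔n _ (suc c)))
      c-stable = fun-stable (m≤n⊔m (suc a ⊔ suc b) (suc c))

  back-and-forth : Is3HTStr M → Is3HTStr N → OnePointExtension M → OnePointExtension N → Iso3 M N
  back-and-forth hM hN extM extN =
    chain-limit stage (λ n → proj₁ (proj₂ (grow n))) (λ n → proj₁ (proj₂ (proj₂ (grow n))))
                (λ n → proj₂ (proj₂ (proj₂ (grow n))))
    where
    forth-and-back : (π : PartialIso M N) (n : ℕ) → Σ (PartialIso M N) λ ρ → π ⊑ ρ × n ∈ domain ρ × InRange ρ n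
    forth-and-back π n =
      let (π₁ , π⊑π₁ , n∈π₁) = forth hM extN π n ; (π₂ , π₁⊑π₂ , n-in-range) = back hN extM π₁ n
      in π₂ , ⊑-trans {π = π} {π₁} {π₂} π⊑π₁ π₁⊑π₂ , proj₁ (π₁⊑π₂ n∈π₁) , n-in-range
    empty : PartialIso M N
    empty = record { domain = [] ; to = id ; from = id ; from-to = λ () ; preserves = λ () }
    stage : ℕ → PartialIso M N
    grow : (n : ℕ) → Σ (PartialIso M N) λ ρ → stage n ⊑ ρ × n ∈ domain ρ × InRange ρ n
    stage zero    = empty
    stage (suc n) = proj₁ (grow n)
    grow n = forth-and-back (stage n) n

T3-onePointExtension : {N : Str3 ℕ} → IsT3 N → OnePointExtension N
T3-onePointExtension hN F hF emb-j x = extension₃ _≟_ hN (Is3HT⇒Is3HTOn hF) there emb-j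

reduct-onePointExtension : {M : Str32 ℕ} → IsT32 M → OnePointExtension (reduct M)
reduct-onePointExtension {M} hM F hF {L} {j} emb-j x =
  f , record { injective = EmbeddingOn₃₂.injective f-embedding ; preserves = EmbeddingOn₃₂.preserves₀ f-embedding } ,
  f≡j
  where
  open EmbeddingOn₃ emb-j
  tour = proj₂ (proj₁ hM)
  k = proj₁ (injective-extension j injective x)
  k-injective = proj₁ (proj₂ (injective-extension j injective x))
  k≡j = proj₂ (proj₂ (injective-extension j injective x))
  G : Str32 ℕ
  G = record { R₀ = Str3.R F ; R₁ = λ a b → Str32.R₁ M (k a) (k b) }
  hG : Is32HTOn (x ∷ L) G
  hG = Is3HT⇒Is3HTOn hF ,
       record { irreflexive   = λ _ → proj₁ tour _
              ; one-direction = λ a∈ b∈ a≢b → proj₂ tour _ _ (a≢b ∘ k-injective a∈ b∈) }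
  emb-j₃₂ : EmbeddingOn₃₂ G M L j
  emb-j₃₂ = record
    { injective  = injective
    ; preserves₀ = preserves
    ; preserves₁ = λ a∈L b∈L → ↔-cong₂ (Str32.R₁ M) (k≡j a∈L) (k≡j b∈L)
    }
  extended = extension₃₂ _≟_ hM hG there emb-j₃₂
  f = proj₁ extended
  f-embedding = proj₁ (proj₂ extended)
  f≡j = proj₂ (proj₂ extended)

module _ {A X Y : List ℕ} where

  open DecMembership _≟_ using (_∈?_)

  private
    outside-AY : ∀ {w} → w ∈ A ++ X ++ Y → w ∉ A ++ Y → w ∈ X ∖ A
    outside-AY w∈ w∉ with ∈-++⁻ A w∈
    ... | inj₁ w∈A  = ⊥-elim (w∉ (∈-++⁺ˡ w∈A))
    ... | inj₂ w∈XY with ∈-++⁻ X w∈XY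
    ...   | inj₁ w∈X = w∈X , w∉ ∘ ∈-++⁺ˡ
    ...   | inj₂ w∈Y = ⊥-elim (w∉ (∈-++⁺ʳ A w∈Y))

    outside-AX : ∀ {w} → w ∈ A ++ X ++ Y → w ∉ A ++ X → w ∈ Y ∖ A
    outside-AX w∈ w∉ with ∈-++⁻ A w∈
    ... | inj₁ w∈A  = ⊥-elim (w∉ (∈-++⁺ˡ w∈A))
    ... | inj₂ w∈XY with ∈-++⁻ X w∈XY
    ...   | inj₁ w∈X = ⊥-elim (w∉ (∈-++⁺ʳ A w∈X))
    ...   | inj₂ w∈Y = w∈Y , w∉ ∘ ∈-++⁺ˡ

  tuple-trichotomy : ∀ {t} → All (_∈ A ++ X ++ Y) t →
                     All (_∈ A ++ X) t ⊎ All (_∈ A ++ Y) t ⊎ (Any (_∈ X ∖ A) t × Any (_∈ Y ∖ A) t)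
  tuple-trichotomy {t} t⊆ with all? (_∈? A ++ X) t | all? (_∈? A ++ Y) t
  ... | yes t⊆AX | _         = inj₁ t⊆AX
  ... | no _     | yes t⊆AY = inj₂ (inj₁ t⊆AY)
  ... | no t⊈AX  | no t⊈AY  =
    inj₂ (inj₂ (All×¬All⇒Any (_∈? A ++ Y) outside-AY t⊆ t⊈AY , All×¬All⇒Any (_∈? A ++ X) outside-AX t⊆ t⊈AX))

module Independence (M : Str32 ℕ) where

  open Str32 M
  open DecMembership _≟_ using (_∈?_)

  record Independent (X A Y : List ℕ) : Set where
    field
      disjoint : ∀ {x} → x ∈ X → x ∈ Y → x ∈ A
      arcs     : ∀ {p q} → p ∈ X ∖ A → q ∈ Y ∖ A → R₁ p q
      induced  : ∀ {a b c} → All (_∈ A ++ X ++ Y) (a ∷ b ∷ c ∷ []) →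
                 Any (_∈ X ∖ A) (a ∷ b ∷ c ∷ []) → Any (_∈ Y ∖ A) (a ∷ b ∷ c ∷ []) →
                 R₀ a b c ↔ Cyclic R₁ a b c

    separated : ∀ {x} → x ∈ X ∖ A → x ∈ Y ∖ A → ⊥
    separated (x∈X , x∉A) (x∈Y , _) = x∉A (disjoint x∈X x∈Y)

  open Independent

  Independent-weaken : ∀ {X A Y X' A' Y'} → X' ⊆ X → Y' ⊆ Y → A ⊆ A' → A' ⊆ A ++ X ++ Y →
                       Independent X A Y → Independent X' A' Y'
  Independent-weaken {X} {A} {Y} {A' = A'} X'⊆X Y'⊆Y A⊆A' A'⊆AXY ind = record
    { disjoint = λ x∈X' x∈Y' → A⊆A' (disjoint ind (X'⊆X x∈X') (Y'⊆Y x∈Y'))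
    ; arcs     = λ p∈ q∈ → arcs ind (shrink X'⊆X p∈) (shrink Y'⊆Y q∈)
    ; induced  = λ t⊆ x∈ y∈ → induced ind (All.map A'X'Y'⊆AXY t⊆) (Any.map (shrink X'⊆X) x∈) (Any.map (shrink Y'⊆Y) y∈)
    }
    where
    shrink : ∀ {Z' Z x} → Z' ⊆ Z → x ∈ Z' ∖ A' → x ∈ Z ∖ A
    shrink Z'⊆Z (x∈Z' , x∉A') = Z'⊆Z x∈Z' , x∉A' ∘ A⊆A'
    A'X'Y'⊆AXY = ++-⊆ A'⊆AXY (++-⊆ (∈-++⁺ʳ A ∘ ∈-++⁺ˡ ∘ X'⊆X) (∈-++⁺ʳ A ∘ ∈-++⁺ʳ X ∘ Y'⊆Y))

  module _ (g : Aut32 M) where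

    private
      gf = Aut32.fun g

      ∈-map⁻¹ : ∀ {x L} → gf x ∈ map gf L → x ∈ L
      ∈-map⁻¹ {L = L} gx∈ with ∈-map⁻ gf gx∈
      ... | y , y∈ , gx≡gy = subst (_∈ L) (sym (Aut32-injective g _ _ gx≡gy)) y∈

      ∖-map⁻¹ : ∀ {x X A} → gf x ∈ map gf X ∖ map gf A → x ∈ X ∖ A
      ∖-map⁻¹ (gx∈ , gx∉) = ∈-map⁻¹ gx∈ , gx∉ ∘ ∈-map⁺ gf

    Independent-map : ∀ {X A Y} → Independent X A Y → Independent (map gf X) (map gf A) (map gf Y)
    Independent-map {X} {A} {Y} ind = record { disjoint = disjoint' ; arcs = arcs' ; induced = induced' }
      where
      disjoint' : ∀ {x} → x ∈ map gf X → x ∈ map gf Y → x ∈ map gf A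
      disjoint' x∈ x∈' with ∈-map⁻ gf x∈
      ... | w , w∈X , refl = ∈-map⁺ gf (disjoint ind w∈X (∈-map⁻¹ x∈'))
      arcs' : ∀ {p q} → p ∈ map gf X ∖ map gf A → q ∈ map gf Y ∖ map gf A → R₁ p q
      arcs' p∈@(p∈X , _) q∈@(q∈Y , _) with ∈-map⁻ gf p∈X | ∈-map⁻ gf q∈Y
      ... | _ , _ , refl | _ , _ , refl = proj₁ (Aut32.pres₁ g _ _) (arcs ind (∖-map⁻¹ p∈) (∖-map⁻¹ q∈))
      image : ∀ {x} → x ∈ map gf A ++ map gf X ++ map gf Y → x ∈ map gf (A ++ X ++ Y)
      image = subst (_ ∈_) (sym (trans (map-++ gf A (X ++ Y)) (cong (map gf A ++_) (map-++ gf X Y))))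
      induced' : ∀ {a b c} → All (_∈ map gf A ++ map gf X ++ map gf Y) (a ∷ b ∷ c ∷ []) →
                 Any (_∈ map gf X ∖ map gf A) (a ∷ b ∷ c ∷ []) → Any (_∈ map gf Y ∖ map gf A) (a ∷ b ∷ c ∷ []) →
                 R₀ a b c ↔ Cyclic R₁ a b c
      induced' (a∈ ∷ b∈ ∷ c∈ ∷ []) x∈ y∈
        with ∈-map⁻ gf (image a∈) | ∈-map⁻ gf (image b∈) | ∈-map⁻ gf (image c∈)
      ... | a , a∈' , refl | b , b∈' , refl | c , c∈' , refl =
        ↔-trans (↔-sym (Aut32.pres₀ g a b c))
          (↔-trans (induced ind (a∈' ∷ b∈' ∷ c∈' ∷ [])
                                (Any.map ∖-map⁻¹ (Any.map⁻ x∈)) (Any.map ∖-map⁻¹ (Any.map⁻ y∈)))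
                   (Cyclic-resp-↔ R₁ R₁ (Aut32.pres₁ g a b) (Aut32.pres₁ g b c) (Aut32.pres₁ g c a)))

  module _ (hM : IsT32 M) where

    private
      asymmetric = IsTour-asymmetric (proj₂ (proj₁ hM))

    module Glue {X A Y X' Y' : List ℕ} (ind : Independent X A Y) (ind' : Independent X' A Y')
                (σ τ : Aut32 M) (σ-fixes : Fixes {M} σ A) (τ-fixes : Fixes {M} τ A)
                (σX⊆X' : ∀ {x} → x ∈ X → Aut32.fun σ x ∈ X') (τY⊆Y' : ∀ {y} → y ∈ Y → Aut32.fun τ y ∈ Y') where

      glue : ℕ → ℕ
      glue w with w ∈? X
      ... | yes _ = Aut32.fun σ w
      ... | no _  = Aut32.fun τ w

      glue-σ : ∀ {w} → w ∈ A ++ X → glue w ≡ Aut32.fun σ w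
      glue-σ {w} w∈ with w ∈? X
      ... | yes _   = refl
      ... | no w∉X = trans (τ-fixes w w∈A) (sym (σ-fixes w w∈A))
        where w∈A = [ id , ⊥-elim ∘ w∉X ]′ (∈-++⁻ A w∈)

      glue-τ : ∀ {w} → w ∈ A ++ Y → glue w ≡ Aut32.fun τ w
      glue-τ {w} w∈ with w ∈? X
      ... | yes w∈X = trans (σ-fixes w w∈A) (sym (τ-fixes w w∈A))
        where w∈A = [ id , disjoint ind w∈X ]′ (∈-++⁻ A w∈)
      ... | no _    = refl

      glue-on-AX : EmbeddingOn₃₂ M M (A ++ X) glue
      glue-on-AX = EmbeddingOn₃₂-cong (Aut32-embeddingOn σ) glue-σ

      glue-on-AY : EmbeddingOn₃₂ M M (A ++ Y) glue
      glue-on-AY = EmbeddingOn₃₂-cong (Aut32-embeddingOn τ) glue-τ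

      glue-X : ∀ {x} → x ∈ X ∖ A → glue x ∈ X' ∖ A
      glue-X (x∈X , x∉A) rewrite glue-σ (∈-++⁺ʳ A x∈X) = σX⊆X' x∈X , Fixes-∉ σ σ-fixes x∉A

      glue-Y : ∀ {y} → y ∈ Y ∖ A → glue y ∈ Y' ∖ A
      glue-Y (y∈Y , y∉A) rewrite glue-τ (∈-++⁺ʳ A y∈Y) = τY⊆Y' y∈Y , Fixes-∉ τ τ-fixes y∉A

      glue-∈ : ∀ {w} → w ∈ A ++ X ++ Y → glue w ∈ A ++ X' ++ Y'
      glue-∈ {w} w∈ with ∈-++⁻ A w∈
      ... | inj₁ w∈A rewrite glue-σ (∈-++⁺ˡ w∈A) | σ-fixes w w∈A = ∈-++⁺ˡ w∈A
      ... | inj₂ w∈XY with ∈-++⁻ X w∈XY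
      ...   | inj₁ w∈X rewrite glue-σ (∈-++⁺ʳ A w∈X) = ∈-++⁺ʳ A (∈-++⁺ˡ (σX⊆X' w∈X))
      ...   | inj₂ w∈Y rewrite glue-τ (∈-++⁺ʳ A w∈Y) = ∈-++⁺ʳ A (∈-++⁺ʳ X' (τY⊆Y' w∈Y))

      glue-injective : ∀ {a b} → a ∈ A ++ X ++ Y → b ∈ A ++ X ++ Y → glue a ≡ glue b → a ≡ b
      glue-injective a∈ b∈ eq with tuple-trichotomy (a∈ ∷ b∈ ∷ [])
      ... | inj₁ (a∈AX ∷ b∈AX ∷ [])        = EmbeddingOn₃₂.injective glue-on-AX a∈AX b∈AX eq
      ... | inj₂ (inj₁ (a∈AY ∷ b∈AY ∷ [])) = EmbeddingOn₃₂.injective glue-on-AY a∈AY b∈AY eq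
      ... | inj₂ (inj₂ (x∈ , y∈)) with Any-pair (separated ind) x∈ y∈
      ...   | inj₁ (a∈X , b∈Y) = ⊥-elim (separated ind' (glue-X a∈X) (subst (_∈ Y' ∖ A) (sym eq) (glue-Y b∈Y)))
      ...   | inj₂ (b∈X , a∈Y) = ⊥-elim (separated ind' (glue-X b∈X) (subst (_∈ Y' ∖ A) eq (glue-Y a∈Y)))

      glue-preserves₁ : ∀ {a b} → a ∈ A ++ X ++ Y → b ∈ A ++ X ++ Y → R₁ a b ↔ R₁ (glue a) (glue b)
      glue-preserves₁ a∈ b∈ with tuple-trichotomy (a∈ ∷ b∈ ∷ [])
      ... | inj₁ (a∈AX ∷ b∈AX ∷ [])        = EmbeddingOn₃₂.preserves₁ glue-on-AX a∈AX b∈AX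
      ... | inj₂ (inj₁ (a∈AY ∷ b∈AY ∷ [])) = EmbeddingOn₃₂.preserves₁ glue-on-AY a∈AY b∈AY
      ... | inj₂ (inj₂ (x∈ , y∈)) with Any-pair (separated ind) x∈ y∈
      ...   | inj₁ (a∈X , b∈Y) = (λ _ → arcs ind' (glue-X a∈X) (glue-Y b∈Y)) , (λ _ → arcs ind a∈X b∈Y)
      ...   | inj₂ (b∈X , a∈Y) = (λ r → ⊥-elim (asymmetric r (arcs ind b∈X a∈Y))) ,
                                 (λ r → ⊥-elim (asymmetric r (arcs ind' (glue-X b∈X) (glue-Y a∈Y))))

      glue-preserves₀ : ∀ {a b c} → a ∈ A ++ X ++ Y → b ∈ A ++ X ++ Y → c ∈ A ++ X ++ Y →
                        R₀ a b c ↔ R₀ (glue a) (glue b) (glue c)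
      glue-preserves₀ a∈ b∈ c∈ with tuple-trichotomy (a∈ ∷ b∈ ∷ c∈ ∷ [])
      ... | inj₁ (a∈AX ∷ b∈AX ∷ c∈AX ∷ [])        = EmbeddingOn₃₂.preserves₀ glue-on-AX a∈AX b∈AX c∈AX
      ... | inj₂ (inj₁ (a∈AY ∷ b∈AY ∷ c∈AY ∷ [])) = EmbeddingOn₃₂.preserves₀ glue-on-AY a∈AY b∈AY c∈AY
      ... | inj₂ (inj₂ (x∈ , y∈)) =
        ↔-trans (induced ind (a∈ ∷ b∈ ∷ c∈ ∷ []) x∈ y∈)
          (↔-trans (Cyclic-resp-↔ R₁ R₁ (glue-preserves₁ a∈ b∈) (glue-preserves₁ b∈ c∈) (glue-preserves₁ c∈ a∈))
                   (↔-sym (induced ind' (glue-∈ a∈ ∷ glue-∈ b∈ ∷ glue-∈ c∈ ∷ [])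
                                        (Any.map⁺ (Any.map glue-X x∈)) (Any.map⁺ (Any.map glue-Y y∈)))))

      glue-embedding : EmbeddingOn₃₂ M M (A ++ X ++ Y) glue
      glue-embedding = record
        { injective = glue-injective ; preserves₀ = glue-preserves₀ ; preserves₁ = glue-preserves₁ }

    amalgamate : ∀ {X A Y X' Y'} → Independent X A Y → Independent X' A Y' →
                 (σ τ : Aut32 M) → Fixes {M} σ A → Fixes {M} τ A →
                 (∀ {x} → x ∈ X → Aut32.fun σ x ∈ X') → (∀ {y} → y ∈ Y → Aut32.fun τ y ∈ Y') →
                 Σ (Aut32 M) λ ρ → AgreesOn {M} ρ σ (A ++ X) × AgreesOn {M} ρ τ (A ++ Y)
    amalgamate {X} {A} {Y} ind ind' σ τ σ-fixes τ-fixes σX⊆X' τY⊆Y' =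
      ρ , (λ w w∈ → trans (ρ≡glue (AX⊆AXY w∈)) (glue-σ w∈)) , (λ w w∈ → trans (ρ≡glue (AY⊆AXY w∈)) (glue-τ w∈))
      where
      open Glue ind ind' σ τ σ-fixes τ-fixes σX⊆X' τY⊆Y'
      conjugator = homogeneous₃₂ _≟_ (proj₁ (proj₂ hM)) EmbeddingOn₃₂-id glue-embedding
      ρ = proj₁ conjugator
      ρ≡glue = proj₂ conjugator
      AX⊆AXY : A ++ X ⊆ A ++ X ++ Y
      AX⊆AXY = ++⁺ʳ A (xs⊆xs++ys X Y)
      AY⊆AXY : A ++ Y ⊆ A ++ X ++ Y
      AY⊆AXY = ++⁺ʳ A (xs⊆ys++xs Y X)

    module Amalgam (A B C : List ℕ) where

      -- The amalgam of AB and AC over A: its points are those of A, copies of those of B∖A (left)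
      -- and those of C∖A (right).
      Point : Set
      Point = ℕ ⊎ ℕ ⊎ ℕ

      pattern base a  = inj₁ a
      pattern left b  = inj₂ (inj₁ b)
      pattern right c = inj₂ (inj₂ c)

      underlying : Point → ℕ
      underlying (base a)  = a
      underlying (left b)  = b
      underlying (right c) = c

      IsPoint : Point → Set
      IsPoint (base a)  = a ∈ A
      IsPoint (left b)  = b ∈ B ∖ A
      IsPoint (right c) = c ∈ C ∖ A

      isPoint? : Decidable IsPoint
      isPoint? (base a)  = a ∈? A
      isPoint? (left b)  = b ∈? B ×-dec ¬? (b ∈? A)
      isPoint? (right c) = c ∈? C ×-dec ¬? (c ∈? A)

      candidates points : List Point
      candidates = map base A ++ map left B ++ map right C
      points     = filter isPoint? candidates

      points⁺ : ∀ {ξ} → IsPoint ξ → ξ ∈ points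
      points⁺ {base a}  a∈A           = ∈-filter⁺ isPoint? (∈-++⁺ˡ (∈-map⁺ base a∈A)) a∈A
      points⁺ {left b}  b∈@(b∈B , _) = ∈-filter⁺ isPoint? (∈-++⁺ʳ (map base A) (∈-++⁺ˡ (∈-map⁺ left b∈B))) b∈
      points⁺ {right c} c∈@(c∈C , _) =
        ∈-filter⁺ isPoint? (∈-++⁺ʳ (map base A) (∈-++⁺ʳ (map left B) (∈-map⁺ right c∈C))) c∈

      points⁻ : ∀ {ξ} → ξ ∈ points → IsPoint ξ
      points⁻ = proj₂ ∘ ∈-filter⁻ isPoint? {xs = candidates}

      IsLeft IsRight : Point → Set
      IsLeft (left _)   = ⊤
      IsLeft _          = ⊥
      IsRight (right _) = ⊤
      IsRight _         = ⊥

      isLeft? : Decidable IsLeft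
      isLeft? (base _)  = no id
      isLeft? (left _)  = yes tt
      isLeft? (right _) = no id

      isRight? : Decidable IsRight
      isRight? (base _)  = no id
      isRight? (left _)  = no id
      isRight? (right _) = yes tt

      left-and-right : ∀ {ξ} → IsLeft ξ → IsRight ξ → ⊥
      left-and-right {left _} _ ()

      Crossing : List Point → Set
      Crossing t = Any IsLeft t × Any IsRight t

      crossing? : Decidable Crossing
      crossing? t = any? isLeft? t ×-dec any? isRight? t

      Crossing-⊆ : ∀ {t t'} → t ⊆ t' → Crossing t → Crossing t'
      Crossing-⊆ t⊆t' (l , r) = Any-resp-⊆ t⊆t' l , Any-resp-⊆ t⊆t' r

      crossing-pair : ∀ {ξ η} → Crossing (ξ ∷ η ∷ []) → (IsLeft ξ × IsRight η) ⊎ (IsLeft η × IsRight ξ)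
      crossing-pair (l , r) = Any-pair left-and-right l r

      ¬Crossing-without-left : ∀ {t} → All (¬_ ∘ IsLeft) t → ¬ Crossing t
      ¬Crossing-without-left no-left (l , _) = All¬⇒¬Any no-left l

      ¬Crossing-without-right : ∀ {t} → All (¬_ ∘ IsRight) t → ¬ Crossing t
      ¬Crossing-without-right no-right (_ , r) = All¬⇒¬Any no-right r

      same-underlying : ∀ {ξ η} → IsPoint ξ → IsPoint η → underlying ξ ≡ underlying η →
                        ξ ≡ η ⊎ Crossing (ξ ∷ η ∷ [])
      same-underlying {base _}  {base _}  _   _         refl = inj₁ refl
      same-underlying {left _}  {left _}  _   _         refl = inj₁ refl
      same-underlying {right _} {right _} _   _         refl = inj₁ refl
      same-underlying {left _}  {right _} _   _         _    = inj₂ (here tt , there (here tt))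
      same-underlying {right _} {left _}  _   _         _    = inj₂ (there (here tt) , here tt)
      same-underlying {base _}  {left _}  a∈A (_ , a∉A) refl = ⊥-elim (a∉A a∈A)
      same-underlying {base _}  {right _} a∈A (_ , a∉A) refl = ⊥-elim (a∉A a∈A)
      same-underlying {left _}  {base _}  (_ , a∉A) a∈A refl = ⊥-elim (a∉A a∈A)
      same-underlying {right _} {base _}  (_ , a∉A) a∈A refl = ⊥-elim (a∉A a∈A)

      underlying-≢ : ∀ {ξ η} → ξ ∈ points → η ∈ points → ξ ≢ η → ¬ Crossing (ξ ∷ η ∷ []) →
                     underlying ξ ≢ underlying η
      underlying-≢ ξ∈ η∈ ξ≢η ¬crossing eq = [ ξ≢η , ¬crossing ]′ (same-underlying (points⁻ ξ∈) (points⁻ η∈) eq)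

      arc : Point → Point → Set
      arc ξ η = Guarded (Crossing (ξ ∷ η ∷ [])) (IsLeft ξ) (R₁ (underlying ξ) (underlying η))

      triangle : Point → Point → Point → Set
      triangle ξ η ζ = Guarded (Crossing (ξ ∷ η ∷ ζ ∷ [])) (Cyclic arc ξ η ζ)
                               (R₀ (underlying ξ) (underlying η) (underlying ζ))

      amalgam : Str32 Point
      amalgam = record { R₀ = triangle ; R₁ = arc }

      arc-tournament : IsTourOn points arc
      arc-tournament = record { irreflexive = irreflexive ; one-direction = one-direction }
        where
        tour = proj₂ (proj₁ hM)
        irreflexive : ∀ {ξ} → ξ ∈ points → ¬ arc ξ ξ
        irreflexive _ (inj₁ (crossing , _)) = [ uncurry left-and-right , uncurry left-and-right ]′ (crossing-pair crossing)
        irreflexive _ (inj₂ (_ , r))        = proj₁ tour _ r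
        one-direction : ∀ {ξ η} → ξ ∈ points → η ∈ points → ξ ≢ η → ExactlyOne (arc ξ η) (arc η ξ)
        one-direction {ξ} {η} ξ∈ η∈ ξ≢η with crossing? (ξ ∷ η ∷ [])
        ... | yes crossing =
          ExactlyOne-resp-↔ (↔-sym (Guarded-yes crossing)) (↔-sym (Guarded-yes (Crossing-⊆ (pair-⊆ 2nd 1st) crossing)))
            ([ (λ (l , r) → inj₁ l , λ (_ , l') → left-and-right l' r) ,
               (λ (l , r) → inj₂ l , λ (l' , _) → left-and-right l' r) ]′ (crossing-pair crossing))
        ... | no ¬crossing =
          ExactlyOne-resp-↔ (↔-sym (Guarded-no ¬crossing)) (↔-sym (Guarded-no (¬crossing ∘ Crossing-⊆ (pair-⊆ 2nd 1st))))
            (proj₂ tour _ _ (underlying-≢ ξ∈ η∈ ξ≢η ¬crossing))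

      triangle-3HT : Is3HTOn points triangle
      triangle-3HT = record { distinct = distinct ; rotate = rotate ; one-orientation = one-orientation }
        where
        ht = proj₁ (proj₁ hM)
        cyclic = Cyclic-Is3HTOn arc-tournament
        distinct : ∀ {ξ η ζ} → ξ ∈ points → η ∈ points → ζ ∈ points → triangle ξ η ζ → (ξ ≢ η) × (η ≢ ζ) × (ξ ≢ ζ)
        distinct ξ∈ η∈ ζ∈ (inj₁ (_ , cyc)) = Is3HTOn.distinct cyclic ξ∈ η∈ ζ∈ cyc
        distinct ξ∈ η∈ ζ∈ (inj₂ (_ , r)) =
          let (ξ≢η , η≢ζ , ξ≢ζ) = proj₁ ht _ _ _ r
          in ξ≢η ∘ cong underlying , η≢ζ ∘ cong underlying , ξ≢ζ ∘ cong underlying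
        rotate : ∀ {ξ η ζ} → ξ ∈ points → η ∈ points → ζ ∈ points → triangle ξ η ζ → triangle η ζ ξ
        rotate _ _ _ (inj₁ (crossing , cyc)) = inj₁ (Crossing-⊆ (triple-⊆ 3rd 1st 2nd) crossing , Cyclic-rotate {T = arc} cyc)
        rotate _ _ _ (inj₂ (¬crossing , r))  = inj₂ (¬crossing ∘ Crossing-⊆ (triple-⊆ 2nd 3rd 1st) , proj₁ (proj₂ ht) _ _ _ r)
        one-orientation : ∀ {ξ η ζ} → ξ ∈ points → η ∈ points → ζ ∈ points → ξ ≢ η → η ≢ ζ → ξ ≢ ζ →
                          ExactlyOne (triangle ξ η ζ) (triangle ξ ζ η)
        one-orientation {ξ} {η} {ζ} ξ∈ η∈ ζ∈ ξ≢η η≢ζ ξ≢ζ with crossing? (ξ ∷ η ∷ ζ ∷ [])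
        ... | yes crossing =
          ExactlyOne-resp-↔ (↔-sym (Guarded-yes crossing)) (↔-sym (Guarded-yes (Crossing-⊆ (triple-⊆ 1st 3rd 2nd) crossing)))
            (Is3HTOn.one-orientation cyclic ξ∈ η∈ ζ∈ ξ≢η η≢ζ ξ≢ζ)
        ... | no ¬crossing =
          ExactlyOne-resp-↔ (↔-sym (Guarded-no ¬crossing)) (↔-sym (Guarded-no (¬crossing ∘ Crossing-⊆ (triple-⊆ 1st 3rd 2nd))))
            (proj₂ (proj₂ ht) _ _ _ (underlying-≢ ξ∈ η∈ ξ≢η (¬crossing ∘ Crossing-⊆ (pair-⊆ 1st 2nd)))
                                    (underlying-≢ η∈ ζ∈ η≢ζ (¬crossing ∘ Crossing-⊆ (pair-⊆ 2nd 3rd)))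
                                    (underlying-≢ ξ∈ ζ∈ ξ≢ζ (¬crossing ∘ Crossing-⊆ (pair-⊆ 1st 3rd))))

      old : List Point
      old = filter (¬? ∘ isLeft?) points

      old⁺ : ∀ {ξ} → IsPoint ξ → ¬ IsLeft ξ → ξ ∈ old
      old⁺ ξ-point ¬left = ∈-filter⁺ (¬? ∘ isLeft?) (points⁺ ξ-point) ¬left

      old-embedding : EmbeddingOn₃₂ amalgam M old underlying
      old-embedding = record
        { injective  = λ ξ∈ η∈ eq → [ id , ⊥-elim ∘ ¬Crossing-without-left (¬left ξ∈ ∷ ¬left η∈ ∷ []) ]′
                                      (same-underlying (points⁻ (⊆points ξ∈)) (points⁻ (⊆points η∈)) eq)
        ; preserves₀ = λ ξ∈ η∈ ζ∈ → Guarded-no (¬Crossing-without-left (¬left ξ∈ ∷ ¬left η∈ ∷ ¬left ζ∈ ∷ []))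
        ; preserves₁ = λ ξ∈ η∈ → Guarded-no (¬Crossing-without-left (¬left ξ∈ ∷ ¬left η∈ ∷ []))
        }
        where
        ⊆points = filter-⊆ (¬? ∘ isLeft?) points
        ¬left : ∀ {ξ} → ξ ∈ old → ¬ IsLeft ξ
        ¬left = proj₂ ∘ ∈-filter⁻ (¬? ∘ isLeft?) {xs = points}

      ι : ℕ → Point
      ι w with w ∈? A
      ... | yes _ = base w
      ... | no _  = left w

      ι-base : ∀ {w} → w ∈ A → ι w ≡ base w
      ι-base {w} w∈A with w ∈? A
      ... | yes _   = refl
      ... | no w∉A = ⊥-elim (w∉A w∈A)

      ι-left : ∀ {w} → w ∉ A → ι w ≡ left w
      ι-left {w} w∉A with w ∈? A
      ... | yes w∈A = ⊥-elim (w∉A w∈A)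
      ... | no _    = refl

      underlying-ι : ∀ w → underlying (ι w) ≡ w
      underlying-ι w with w ∈? A
      ... | yes _ = refl
      ... | no _  = refl

      ¬right-ι : ∀ w → ¬ IsRight (ι w)
      ¬right-ι w with w ∈? A
      ... | yes _ = id
      ... | no _  = id

      ι∈points : ∀ {w} → w ∈ A ++ B → ι w ∈ points
      ι∈points {w} w∈ with w ∈? A
      ... | yes w∈A = points⁺ w∈A
      ... | no w∉A  = points⁺ ([ ⊥-elim ∘ w∉A , id ]′ (∈-++⁻ A w∈) , w∉A)

      ι-embedding : ∀ {L} → EmbeddingOn₃₂ M amalgam L ι
      ι-embedding = record
        { injective  = λ {a} {b} _ _ eq → trans (sym (underlying-ι a)) (trans (cong underlying eq) (underlying-ι b))
        ; preserves₀ = λ {a} {b} {c} _ _ _ →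
            ↔-trans (↔-cong₃ R₀ (sym (underlying-ι a)) (sym (underlying-ι b)) (sym (underlying-ι c)))
                    (↔-sym (Guarded-no (¬Crossing-without-right (¬right-ι a ∷ ¬right-ι b ∷ ¬right-ι c ∷ []))))
        ; preserves₁ = λ {a} {b} _ _ →
            ↔-trans (↔-cong₂ R₁ (sym (underlying-ι a)) (sym (underlying-ι b)))
                    (↔-sym (Guarded-no (¬Crossing-without-right (¬right-ι a ∷ ¬right-ι b ∷ []))))
        }

      private
        extension = extension₃₂ (≡-dec _≟_ (≡-dec _≟_ _≟_)) hM (triangle-3HT , arc-tournament)
                                (filter-⊆ (¬? ∘ isLeft?) points) old-embedding

      -- Opaque, since otherwise with-abstraction below normalises the constructions behind f and g.
      opaque
        f : Point → ℕ
        f = proj₁ extension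

        f-embedding : EmbeddingOn₃₂ amalgam M points f
        f-embedding = proj₁ (proj₂ extension)

        f-old : ∀ {ξ} → ξ ∈ old → f ξ ≡ underlying ξ
        f-old = proj₂ (proj₂ extension)

      f-base : ∀ {a} → a ∈ A → f (base a) ≡ a
      f-base a∈A = f-old (old⁺ a∈A id)

      f-right : ∀ {c} → c ∈ C ∖ A → f (right c) ≡ c
      f-right c∈ = f-old (old⁺ c∈ id)

      private
        conjugator = homogeneous₃₂ _≟_ (proj₁ (proj₂ hM)) EmbeddingOn₃₂-id
                                   (EmbeddingOn₃₂-∘ ι-embedding f-embedding ι∈points)

      opaque
        g : Aut32 M
        g = proj₁ conjugator

        g≡f∘ι : ∀ {w} → w ∈ A ++ B → Aut32.fun g w ≡ f (ι w)
        g≡f∘ι = proj₂ conjugator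

      g-fixes : Fixes {M} g A
      g-fixes a a∈A = trans (g≡f∘ι (∈-++⁺ˡ a∈A)) (trans (cong f (ι-base a∈A)) (f-base a∈A))

      g-disjoint : ∀ {x} → x ∈ map (Aut32.fun g) B → x ∈ C → x ∈ A
      g-disjoint {x} x∈gB x∈C with x ∈? A | ∈-map⁻ (Aut32.fun g) x∈gB
      ... | yes x∈A | _              = x∈A
      ... | no x∉A  | w , w∈B , refl = ⊥-elim (¬right-ι w (subst IsRight (sym ιw≡right) tt))
        where
        ιw≡right : ι w ≡ right (Aut32.fun g w)
        ιw≡right = EmbeddingOn₃₂.injective f-embedding (ι∈points (∈-++⁺ʳ A w∈B)) (points⁺ (x∈C , x∉A))
                     (trans (sym (g≡f∘ι (∈-++⁺ʳ A w∈B))) (sym (f-right (x∈C , x∉A))))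

      preimage : ℕ → Point
      preimage x with x ∈? A | x ∈? C
      ... | yes _ | _     = base x
      ... | no _  | yes _ = right x
      ... | no _  | no _  = left (Aut32.inv g x)

      preimage-spec : ∀ {x} → x ∈ A ++ map (Aut32.fun g) B ++ C → preimage x ∈ points × f (preimage x) ≡ x
      preimage-spec {x} x∈ with x ∈? A | x ∈? C
      ... | yes x∈A | _       = points⁺ x∈A , f-base x∈A
      ... | no x∉A  | yes x∈C = points⁺ (x∈C , x∉A) , f-right (x∈C , x∉A)
      ... | no x∉A  | no x∉C  with ∈-map⁻ (Aut32.fun g) x∈gB
        where x∈gB = [ ⊥-elim ∘ x∉A , [ id , ⊥-elim ∘ x∉C ]′ ∘ ∈-++⁻ _ ]′ (∈-++⁻ A x∈)
      ...   | w , w∈B , refl rewrite Aut32.inv-fun g w =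
        points⁺ (w∈B , w∉A) , trans (cong f (sym (ι-left w∉A))) (sym (g≡f∘ι (∈-++⁺ʳ A w∈B)))
        where w∉A = λ w∈A → x∉A (subst (_∈ A) (sym (g-fixes w w∈A)) w∈A)

      preimage-left : ∀ {x} → x ∈ map (Aut32.fun g) B ∖ A → IsLeft (preimage x)
      preimage-left {x} (x∈gB , x∉A) with x ∈? A | x ∈? C
      ... | yes x∈A | _       = x∉A x∈A
      ... | no _    | yes x∈C = x∉A (g-disjoint x∈gB x∈C)
      ... | no _    | no _    = tt

      preimage-right : ∀ {x} → x ∈ C ∖ A → IsRight (preimage x)
      preimage-right {x} (x∈C , x∉A) with x ∈? A | x ∈? C
      ... | yes x∈A | _       = x∉A x∈A
      ... | no _    | yes _   = tt
      ... | no _    | no x∉C  = x∉C x∈C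

      private
        S = A ++ map (Aut32.fun g) B ++ C

      preimage-preserves₀ : ∀ {x y z} → x ∈ S → y ∈ S → z ∈ S → R₀ x y z ↔ triangle (preimage x) (preimage y) (preimage z)
      preimage-preserves₀ x∈ y∈ z∈ =
        ↔-trans (↔-cong₃ R₀ (sym (proj₂ (preimage-spec x∈))) (sym (proj₂ (preimage-spec y∈))) (sym (proj₂ (preimage-spec z∈))))
                (↔-sym (EmbeddingOn₃₂.preserves₀ f-embedding (proj₁ (preimage-spec x∈)) (proj₁ (preimage-spec y∈)) (proj₁ (preimage-spec z∈))))

      preimage-preserves₁ : ∀ {x y} → x ∈ S → y ∈ S → R₁ x y ↔ arc (preimage x) (preimage y)
      preimage-preserves₁ x∈ y∈ =
        ↔-trans (↔-cong₂ R₁ (sym (proj₂ (preimage-spec x∈))) (sym (proj₂ (preimage-spec y∈))))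
                (↔-sym (EmbeddingOn₃₂.preserves₁ f-embedding (proj₁ (preimage-spec x∈)) (proj₁ (preimage-spec y∈))))

      g-independent : Independent (map (Aut32.fun g) B) A C
      g-independent = record
        { disjoint = g-disjoint
        ; arcs     = λ p∈ q∈ → proj₂ (preimage-preserves₁ (∈-++⁺ʳ A (∈-++⁺ˡ (proj₁ p∈))) (∈-++⁺ʳ A (∈-++⁺ʳ _ (proj₁ q∈))))
                                  (proj₂ (Guarded-yes (here (preimage-left p∈) , there (here (preimage-right q∈)))) (preimage-left p∈))
        ; induced  = λ { (a∈ ∷ b∈ ∷ c∈ ∷ []) x∈ y∈ →
            ↔-trans (preimage-preserves₀ a∈ b∈ c∈)
              (↔-trans (Guarded-yes (Any.map⁺ (Any.map preimage-left x∈) , Any.map⁺ (Any.map preimage-right y∈)))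
                       (Cyclic-resp-↔ arc R₁ (↔-sym (preimage-preserves₁ a∈ b∈)) (↔-sym (preimage-preserves₁ b∈ c∈))
                                             (↔-sym (preimage-preserves₁ c∈ a∈)))) }
        }

    existenceʳ : ∀ A B C → Σ (Aut32 M) λ h → Fixes {M} h A × Independent B A (map (Aut32.fun h) C)
    existenceʳ A B C =
      h , h-fixes ,
      Independent-weaken B⊆h[gB] id (Fixes⇒map-⊆ h h-fixes) (∈-++⁺ˡ ∘ Fixes⇒⊆-map h h-fixes)
                         (Independent-map h g-independent)
      where
      open Amalgam A B C using (g; g-fixes; g-independent)
      h = Aut32-inverse g
      h-fixes : Fixes {M} h A
      h-fixes a a∈A = trans (cong (Aut32.inv g) (sym (g-fixes a a∈A))) (Aut32.inv-fun g a)
      B⊆h[gB] : B ⊆ map (Aut32.inv g) (map (Aut32.fun g) B)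
      B⊆h[gB] {b} b∈B = subst (_∈ _) (Aut32.inv-fun g b) (∈-map⁺ (Aut32.inv g) (∈-map⁺ (Aut32.fun g) b∈B))

    swir : SWIR M
    swir = record
      { ind           = Independent
      ; ind-sets      = λ B A C B' A' C' B≈B' A≈A' C≈C' →
                          Independent-weaken (proj₂ (B≈B' _)) (proj₂ (C≈C' _)) (proj₁ (A≈A' _)) (∈-++⁺ˡ ∘ proj₂ (A≈A' _))
      ; invariance    = λ g B A C → Independent-map g
      ; existenceˡ    = λ A B C → let open Amalgam A B C in g , g-fixes , g-independent
      ; existenceʳ    = existenceʳ
      ; stationarityˡ = λ A B B' C ind ind' σ σ-fixes σB≈B' →
          let (ρ , ρ≈σ , ρ≈id) = amalgamate ind ind' σ Aut32-id σ-fixes (λ _ _ → refl)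
                                             (λ b∈B → proj₁ (σB≈B' _) (∈-map⁺ _ b∈B)) id
          in ρ , ρ≈id , λ b b∈B → ρ≈σ b (∈-++⁺ʳ A b∈B)
      ; stationarityʳ = λ A B C C' ind ind' σ σ-fixes σC≈C' →
          let (ρ , ρ≈id , ρ≈σ) = amalgamate ind ind' Aut32-id σ (λ _ _ → refl) σ-fixes
                                             id (λ c∈C → proj₁ (σC≈C' _) (∈-map⁺ _ c∈C))
          in ρ , ρ≈id , λ c c∈C → ρ≈σ c (∈-++⁺ʳ A c∈C)
      ; monotonicityˡ = λ A B C D ind →
          Independent-weaken (xs⊆xs++ys B D) id id (xs⊆xs++ys A _) ind ,
          Independent-weaken (xs⊆ys++xs D B) id (xs⊆xs++ys A B)
                             (++⁺ʳ A (⊆-trans (xs⊆xs++ys B D) (xs⊆xs++ys (B ++ D) C))) ind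
      ; monotonicityʳ = λ A B C D ind →
          Independent-weaken id (xs⊆xs++ys C D) id (xs⊆xs++ys A _) ind ,
          Independent-weaken id (xs⊆ys++xs D C) (xs⊆xs++ys A C)
                             (++⁺ʳ A (⊆-trans (xs⊆xs++ys C D) (xs⊆ys++xs (C ++ D) B))) ind
      }

proposition3p11 : (M : Str32 ℕ) → IsT32 M → (N : Str3 ℕ) → IsT3 N →
                  Iso3 (reduct M) N × SWIR M
proposition3p11 M hM N hN =
  back-and-forth (proj₁ (proj₁ hM)) (proj₁ hN) (reduct-onePointExtension hM) (T3-onePointExtension hN) ,
  Independence.swir M hM
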